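{- Let $D$ be a $k$-strong digraph of order $n+1\geq 5$, where $k\geq 3$. Then for any two distinct vertices $u,v$ of $D$, the digraph $H_D(u,v)$ is $(k-1)$-strong.
   Context: All digraphs are finite, without loops and without multiple arcs. A digraph $D$ is $k$-strong if $|V(D)|\geq k+1$ and $D-A$ is strongly connected for every set $A$ of at most $k-1$ vertices. For a digraph $D$ and distinct vertices $u,v$, $H_D(u,v)$ is the digraph with vertex set $(V(D)\setminus\{u,v\})\cup\{z_0\}$, where $z_0$ is a new vertex, and arc set consisting of all arcs of $D-\{u,v\}$, together with the arcs $z_0y$ for every $y\in V(D)\setminus\{u,v\}$ with $uy\in A(D)$, and the arcs $yz_0$ for every $y\in V(D)\setminus\{u,v\}$ with $yv\in A(D)$. -}

module Defs where

open import Data.Nat using (ℕ; zero; suc; _≤_; _∸_)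
open import Data.Fin using (Fin; zero; suc; punchIn; punchOut)
open import Data.Fin.Subset using (Subset; _∈_; _∉_; ∣_∣)
open import Data.Bool using (Bool; true; false)
open import Data.Product using (_×_)
open import Relation.Binary.PropositionalEquality using (_≡_; _≢_)

-- A digraph on vertex set Fin N: arc relation given as a Boolean adjacency
-- function; a relation automatically excludes multiple arcs, and loops are
-- excluded explicitly.
record Digraph (N : ℕ) : Set where
  field
    arc     : Fin N → Fin N → Bool
    noLoops : ∀ x → arc x x ≡ false
open Digraph public

_⟶[_]_ : ∀ {N} → Fin N → Digraph N → Fin N → Set
x ⟶[ D ] y = arc D x y ≡ true

data WalkAvoiding {N : ℕ} (D : Digraph N) (A : Subset N) : Fin N → Fin N → Set where
  here : ∀ {x} → x ∉ A → WalkAvoiding D A x x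
  step : ∀ {x y z} → x ∉ A → x ⟶[ D ] y → WalkAvoiding D A y z → WalkAvoiding D A x z

StronglyConnectedMinus : ∀ {N} → Digraph N → Subset N → Set
StronglyConnectedMinus {N} D A = ∀ (x y : Fin N) → x ∉ A → y ∉ A → WalkAvoiding D A x y

KStrong : ∀ {N} → ℕ → Digraph N → Set
KStrong {N} k D = (suc k ≤ N) × (∀ (A : Subset N) → ∣ A ∣ ≤ k ∸ 1 → StronglyConnectedMinus D A)

-- H_D(u,v) for D on Fin (suc (suc m)) (order m+2) and u ≢ v.
-- Its vertex set Fin (suc m): zero is the new vertex z₀, and suc i stands for the
-- vertex  emb u v i = punchIn u (punchIn (punchOut u≢v) i)  of D, which ranges
-- bijectively over V(D) ∖ {u,v}.
module _ {m : ℕ} (D : Digraph (suc (suc m))) (u v : Fin (suc (suc m))) (u≢v : u ≢ v) where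

  emb : Fin m → Fin (suc (suc m))
  emb i = punchIn u (punchIn (punchOut u≢v) i)

  private
    harc : Fin (suc m) → Fin (suc m) → Bool
    harc zero    zero    = false
    harc zero    (suc j) = arc D u (emb j)
    harc (suc i) zero    = arc D (emb i) v
    harc (suc i) (suc j) = arc D (emb i) (emb j)

    hloop : ∀ x → harc x x ≡ false
    hloop zero    = Relation.Binary.PropositionalEquality.refl
    hloop (suc i) = noLoops D (emb i)

  H : Digraph (suc m)
  H = record { arc = harc ; noLoops = hloop }

module Submission where

-- Let A be a vertex set of H = H_D(u,v) with |A| ≤ k-2.  Every
-- vertex of D is sent to H by the contraction φ, which maps u and v to the new
-- vertex z₀ and every other vertex to its copy.  An arc a → c of D with a ≠ v,
-- c ≠ u and (a,c) ≠ (u,v) is mapped to an arc φa → φc of H, so walks of D that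
-- never leave v and never enter u project to walks of H.  The set A is pulled
-- back to D as  lift bu bv A  (its ordinary vertices, plus u if bu, plus v if
-- bv), which has at most |A| + 1 ≤ k - 1 elements in the cases we need.
--   * z₀ ∉ A: in D - (A ∪ {u}) every vertex reaches v, and in D - (A ∪ {v})
--     u reaches every vertex; projecting gives x ⇝ z₀ ⇝ y in H - A.
--   * z₀ ∈ A: in D - (A ∪ {u,v}) any two ordinary vertices are joined, and the
--     walk projects directly.  The argument
-- only needs k ≥ 2.

open import Defs
open import Data.Nat using (ℕ; zero; suc; _≤_; _∸_; s≤s; s≤s⁻¹)
open import Data.Nat.Properties using (<⇒≤; ∸-monoˡ-≤; m+n≤o⇒m≤o∸n)
open import Data.Fin using (Fin; zero; suc; punchIn; punchOut; _≟_)
open import Data.Fin.Properties using (punchIn-punchOut; punchInᵢ≢i; punchIn-injective; punchOut-injective)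
open import Data.Fin.Subset using (Subset; _∈_; _∉_; ∣_∣)
open import Data.Bool using (Bool; true; false)
open import Data.Vec using (_∷_; here; there; lookup; insertAt)
open import Data.Vec.Properties using (insertAt-lookup; insertAt-punchIn; []=⇒lookup; lookup⇒[]=)
open import Data.Product using (_×_; _,_)
open import Data.Sum using (_⊎_; inj₁; inj₂)
open import Relation.Nullary using (yes; no; ¬_; contradiction)
open import Relation.Binary.PropositionalEquality using (_≡_; _≢_; refl; sym; trans; cong; subst; subst₂)

walk-++ : ∀ {N} {D : Digraph N} {S x y z}
        → WalkAvoiding D S x y → WalkAvoiding D S y z → WalkAvoiding D S x z
walk-++ (here _)       w′ = w′
walk-++ (step x∉ r w) w′ = step x∉ r (walk-++ w w′)

walk-start-∉ : ∀ {N} {D : Digraph N} {S x y} → WalkAvoiding D S x y → x ∉ S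
walk-start-∉ (here x∉)     = x∉
walk-start-∉ (step x∉ _ _) = x∉

∣insertAt∣ : ∀ {n} (xs : Subset n) i b → ∣ insertAt xs i b ∣ ≡ ∣ b ∷ xs ∣
∣insertAt∣ xs           zero    b     = refl
∣insertAt∣ (true ∷ xs)  (suc i) true  = cong suc (∣insertAt∣ xs i true)
∣insertAt∣ (true ∷ xs)  (suc i) false = cong suc (∣insertAt∣ xs i false)
∣insertAt∣ (false ∷ xs) (suc i) true  = ∣insertAt∣ xs i true
∣insertAt∣ (false ∷ xs) (suc i) false = ∣insertAt∣ xs i false

suc-≤-pred : ∀ {n j} → 1 ≤ j → n ≤ j ∸ 1 → suc n ≤ j
suc-≤-pred (s≤s _) n≤j-1 = s≤s n≤j-1

lookup⇒∈ : ∀ {n} {xs : Subset n} {i} → lookup xs i ≡ true → i ∈ xs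
lookup⇒∈ {xs = xs} {i} = lookup⇒[]= i xs

lookup⇒∉ : ∀ {n} {xs : Subset n} {i} → lookup xs i ≡ false → i ∉ xs
lookup⇒∉ eq i∈ with trans (sym eq) ([]=⇒lookup i∈)
... | ()

module Contraction {m : ℕ} (D : Digraph (suc (suc m))) (u v : Fin (suc (suc m))) (u≢v : u ≢ v) where

  Hᵤᵥ : Digraph (suc m)
  Hᵤᵥ = H D u v u≢v

  e : Fin m → Fin (suc (suc m))
  e = emb D u v u≢v

  p : Fin (suc m)
  p = punchOut u≢v

  v≡punchIn-p : punchIn u p ≡ v
  v≡punchIn-p = punchIn-punchOut u≢v

  e≢u : ∀ j → e j ≢ u
  e≢u j = punchInᵢ≢i u _

  e≢v : ∀ j → e j ≢ v
  e≢v j eq = punchInᵢ≢i p j (punchIn-injective u _ _ (trans eq (sym v≡punchIn-p)))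

  e-injective : ∀ {i j} → e i ≡ e j → i ≡ j
  e-injective eq = punchIn-injective p _ _ (punchIn-injective u _ _ eq)

  data View (c : Fin (suc (suc m))) : Set where
    is-u : c ≡ u → View c
    is-v : c ≡ v → View c
    is-e : ∀ j → c ≡ e j → View c

  view : ∀ c → View c
  view c with c ≟ u
  ... | yes c≡u = is-u c≡u
  ... | no c≢u with c ≟ v
  ...   | yes c≡v = is-v c≡v
  ...   | no c≢v = is-e (punchOut p≢q) (sym e≡c)
    where
    u≢c : u ≢ c
    u≢c u≡c = c≢u (sym u≡c)
    p≢q : p ≢ punchOut u≢c
    p≢q eq = c≢v (sym (punchOut-injective u≢v u≢c eq))
    e≡c : e (punchOut p≢q) ≡ c
    e≡c = trans (cong (punchIn u) (punchIn-punchOut p≢q)) (punchIn-punchOut u≢c)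

  φ : Fin (suc (suc m)) → Fin (suc m)
  φ c with view c
  ... | is-u _   = zero
  ... | is-v _   = zero
  ... | is-e j _ = suc j

  φ-u : φ u ≡ zero
  φ-u with view u
  ... | is-u _    = refl
  ... | is-v _    = refl
  ... | is-e j eq = contradiction (sym eq) (e≢u j)

  φ-v : φ v ≡ zero
  φ-v with view v
  ... | is-u _    = refl
  ... | is-v _    = refl
  ... | is-e j eq = contradiction (sym eq) (e≢v j)

  φ-e : ∀ j → φ (e j) ≡ suc j
  φ-e j with view (e j)
  ... | is-u eq    = contradiction eq (e≢u j)
  ... | is-v eq    = contradiction eq (e≢v j)
  ... | is-e i eq  = cong suc (sym (e-injective eq))

  arc-project : ∀ {a c} → a ⟶[ D ] c → a ≢ v → c ≢ u → ¬ (a ≡ u × c ≡ v)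
              → φ a ⟶[ Hᵤᵥ ] φ c
  arc-project {a} {c} r a≢v c≢u not-uv with view a | view c
  ... | is-v a≡v    | _           = contradiction a≡v a≢v
  ... | _           | is-u c≡u    = contradiction c≡u c≢u
  ... | is-u a≡u    | is-v c≡v    = contradiction (a≡u , c≡v) not-uv
  ... | is-u refl   | is-e j refl = r
  ... | is-e i refl | is-v refl   = r
  ... | is-e i refl | is-e j refl = r

  Covers : Subset (suc (suc m)) → Subset (suc m) → Set
  Covers S A = ∀ {x} → x ∉ S → φ x ∉ A

  HWalk : Subset (suc m) → Fin (suc m) → Fin (suc m) → Set
  HWalk = WalkAvoiding Hᵤᵥ

  -- With u deleted, a walk of D - S that ends at v, or that never meets v
  -- because v ∈ S, projects to a walk of H - A: from its first visit of v on
  -- it is replaced by the trivial walk at z₀, so no arc leaving v is needed.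
  project-toward-v : ∀ {S A a b} → u ∈ S → Covers S A → b ≡ v ⊎ v ∈ S
                   → WalkAvoiding D S a b → HWalk A (φ a) (φ b)
  project-toward-v u∈S cover end (here a∉) = here (cover a∉)
  project-toward-v {S} {A} {a} {b} u∈S cover end (step {y = c} a∉ r w) with a ≟ v
  ... | yes refl = stop end
    where
    stop : b ≡ v ⊎ v ∈ S → HWalk A (φ v) (φ b)
    stop (inj₁ refl) = here (cover a∉)
    stop (inj₂ v∈S)  = contradiction v∈S a∉
  ... | no a≢v = step (cover a∉) (arc-project r a≢v c≢u not-uv) (project-toward-v u∈S cover end w)
    where
    c≢u : c ≢ u
    c≢u refl = walk-start-∉ w u∈S
    not-uv : ¬ (a ≡ u × c ≡ v)
    not-uv (refl , _) = a∉ u∈S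

  -- With v deleted, a walk of D - S from u projects to a walk of H - A from z₀.
  -- Only the part after the last visit of u is projected.
  project-from-u : ∀ {S A b} → v ∈ S → Covers S A
                 → WalkAvoiding D S u b → HWalk A zero (φ b)
  project-from-u {S} {A} {b} v∈S cover w with from-last-u w
    where
    from-last-u : ∀ {a} → WalkAvoiding D S a b → HWalk A zero (φ b) ⊎ HWalk A (φ a) (φ b)
    from-last-u (here a∉) = inj₂ (here (cover a∉))
    from-last-u {a} (step {y = c} a∉ r w) with from-last-u w | c ≟ u
    ... | inj₁ hw | _        = inj₁ hw
    ... | inj₂ hw | yes refl = inj₁ (subst (λ t → HWalk A t (φ b)) φ-u hw)
    ... | inj₂ hw | no c≢u   = inj₂ (step (cover a∉) (arc-project r a≢v c≢u not-uv) hw)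
      where
      a≢v : a ≢ v
      a≢v refl = a∉ v∈S
      not-uv : ¬ (a ≡ u × c ≡ v)
      not-uv (_ , refl) = walk-start-∉ w v∈S
  ... | inj₁ hw = hw
  ... | inj₂ hw = subst (λ t → HWalk A t (φ b)) φ-u hw

  lift : Bool → Bool → Subset m → Subset (suc (suc m))
  lift bu bv As = insertAt (insertAt As p bv) u bu

  lift-u : ∀ bu bv As → lookup (lift bu bv As) u ≡ bu
  lift-u bu bv As = insertAt-lookup _ u bu

  lift-v : ∀ bu bv As → lookup (lift bu bv As) v ≡ bv
  lift-v bu bv As = subst (λ w → lookup (lift bu bv As) w ≡ bv) v≡punchIn-p
    (trans (insertAt-punchIn _ u bu p) (insertAt-lookup As p bv))

  lift-e : ∀ bu bv As j → lookup (lift bu bv As) (e j) ≡ lookup As j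
  lift-e bu bv As j = trans (insertAt-punchIn _ u bu _) (insertAt-punchIn As p bv j)

  ∣lift∣ : ∀ bu bv As → ∣ lift bu bv As ∣ ≡ ∣ bu ∷ bv ∷ As ∣
  ∣lift∣ bu bv As = trans (∣insertAt∣ _ u bu) (prepend bu)
    where
    prepend : ∀ b → ∣ b ∷ insertAt As p bv ∣ ≡ ∣ b ∷ bv ∷ As ∣
    prepend true  = cong suc (∣insertAt∣ As p bv)
    prepend false = ∣insertAt∣ As p bv

  e∉lift⇒ : ∀ {bu bv a₀ As j} → e j ∉ lift bu bv As → suc j ∉ a₀ ∷ As
  e∉lift⇒ {bu} {bv} {As = As} {j} e∉ (there j∈) =
    e∉ (lookup⇒∈ (trans (lift-e bu bv As j) ([]=⇒lookup j∈)))

  ⇒e∉lift : ∀ {bu bv a₀ As j} → suc j ∉ a₀ ∷ As → e j ∉ lift bu bv As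
  ⇒e∉lift {bu} {bv} {As = As} {j} s∉ e∈ =
    s∉ (there (lookup⇒∈ (trans (sym (lift-e bu bv As j)) ([]=⇒lookup e∈))))

  covers-z₀∉ : ∀ {bu bv As} → Covers (lift bu bv As) (false ∷ As)
  covers-z₀∉ {x = x} x∉ with view x
  ... | is-u _      = λ ()
  ... | is-v _      = λ ()
  ... | is-e j refl = e∉lift⇒ x∉

  covers-z₀∈ : ∀ {a₀ As} → Covers (lift true true As) (a₀ ∷ As)
  covers-z₀∈ {As = As} {x} x∉ with view x
  ... | is-u refl   = contradiction (lookup⇒∈ (lift-u true true As)) x∉
  ... | is-v refl   = contradiction (lookup⇒∈ (lift-v true true As)) x∉
  ... | is-e j refl = e∉lift⇒ x∉

  -- If z₀ ∉ A: every vertex of H - A reaches z₀ (project a walk to v in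
  -- D - lift(A) - u) and z₀ reaches every vertex (project a walk from u in
  -- D - lift(A) - v), so H - A is strongly connected.
  connected-z₀∉ : ∀ As → StronglyConnectedMinus D (lift true false As)
                → StronglyConnectedMinus D (lift false true As)
                → StronglyConnectedMinus Hᵤᵥ (false ∷ As)
  connected-z₀∉ As sc-u sc-v x y x∉ y∉ = walk-++ (to-z₀ x x∉) (from-z₀ y y∉)
    where
    z₀∉ : zero ∉ false ∷ As
    z₀∉ ()
    to-z₀ : ∀ x → x ∉ false ∷ As → HWalk (false ∷ As) x zero
    to-z₀ zero    _  = here z₀∉
    to-z₀ (suc i) i∉ = subst₂ (HWalk _) (φ-e i) φ-v
      (project-toward-v (lookup⇒∈ (lift-u true false As)) covers-z₀∉ (inj₁ refl)
        (sc-u (e i) v (⇒e∉lift i∉) (lookup⇒∉ (lift-v true false As))))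
    from-z₀ : ∀ y → y ∉ false ∷ As → HWalk (false ∷ As) zero y
    from-z₀ zero    _  = here z₀∉
    from-z₀ (suc j) j∉ = subst (HWalk _ zero) (φ-e j)
      (project-from-u (lookup⇒∈ (lift-v false true As)) covers-z₀∉
        (sc-v u (e j) (lookup⇒∉ (lift-u false true As)) (⇒e∉lift j∉)))

  connected-z₀∈ : ∀ As → StronglyConnectedMinus D (lift true true As)
                → StronglyConnectedMinus Hᵤᵥ (true ∷ As)
  connected-z₀∈ As sc zero    _       z₀∉ _   = contradiction here z₀∉
  connected-z₀∈ As sc (suc i) zero    _   z₀∉ = contradiction here z₀∉
  connected-z₀∈ As sc (suc i) (suc j) i∉  j∉  = subst₂ (HWalk _) (φ-e i) (φ-e j)
    (project-toward-v (lookup⇒∈ (lift-u true true As)) covers-z₀∈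
      (inj₂ (lookup⇒∈ (lift-v true true As)))
      (sc (e i) (e j) (⇒e∉lift i∉) (⇒e∉lift j∉)))

  -- The lifts used above have one vertex more than the set they lift, so
  -- they are small enough when |A| ≤ k - 2.
  lift-small : ∀ {k} bu bv a₀ As → ∣ bu ∷ bv ∷ As ∣ ≡ suc ∣ a₀ ∷ As ∣
             → 2 ≤ k → ∣ a₀ ∷ As ∣ ≤ k ∸ 1 ∸ 1 → ∣ lift bu bv As ∣ ≤ k ∸ 1
  lift-small {k} bu bv a₀ As one-more 2≤k |A|≤ =
    subst (_≤ k ∸ 1) (sym (trans (∣lift∣ bu bv As) one-more))
      (suc-≤-pred (m+n≤o⇒m≤o∸n 1 2≤k) |A|≤)

  connected-H : ∀ k → 2 ≤ k → (∀ S → ∣ S ∣ ≤ k ∸ 1 → StronglyConnectedMinus D S)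
              → ∀ A → ∣ A ∣ ≤ k ∸ 1 ∸ 1 → StronglyConnectedMinus Hᵤᵥ A
  connected-H k 2≤k sc (false ∷ As) |A|≤ =
    connected-z₀∉ As (sc _ (lift-small true false false As refl 2≤k |A|≤))
                     (sc _ (lift-small false true false As refl 2≤k |A|≤))
  connected-H k 2≤k sc (true ∷ As) |A|≤ =
    connected-z₀∈ As (sc _ (lift-small true true true As refl 2≤k |A|≤))

lemma3p1 : (m k : ℕ) → 3 ≤ k → 5 ≤ suc (suc m)
    → (D : Digraph (suc (suc m))) → KStrong k D
    → (u v : Fin (suc (suc m))) → (u≢v : u ≢ v)
    → KStrong (k ∸ 1) (H D u v u≢v)
lemma3p1 m k 3≤k _ D (k<order , k-strong) u v u≢v = order , connected
  where
  order : suc (k ∸ 1) ≤ suc m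
  order = s≤s (∸-monoˡ-≤ 1 (s≤s⁻¹ k<order))
  connected : ∀ A → ∣ A ∣ ≤ k ∸ 1 ∸ 1 → StronglyConnectedMinus (H D u v u≢v) A
  connected = Contraction.connected-H D u v u≢v k (<⇒≤ 3≤k) k-strong
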